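{- Let $q$ be a prime power, $n\ge 2$, and let $\mathcal X$ be a complete $4$-general set of ${\rm PG}(n,q)$. Then $$|\mathcal X|>\frac{\sqrt[3]{6q^{n+1}-q^2-q+(q^2-5q+1)\sqrt[3]{6q^{n+1}-q^2-q}}}{q-1}+\frac{q-2}{q-1}.$$
   Context: A $4$-general set of ${\rm PG}(n,q)$ is a set of points spanning ${\rm PG}(n,q)$ such that no four of its points lie on a plane. It is complete if it is not contained in a strictly larger $4$-general set of ${\rm PG}(n,q)$. -}

module Defs where

open import Level using (_⊔_)
open import Algebra.Bundles using (CommutativeRing)
open import Data.Nat as ℕ using (ℕ; zero; suc)
open import Data.Fin using (Fin; zero; suc)
open import Data.Product using (Σ; ∃; ∃₂; _×_; _,_)
open import Data.Integer as ℤ using (ℤ; +_)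
open import Relation.Nullary using (¬_)
open import Relation.Binary.PropositionalEquality as ≡ using (_≡_)
open import Function.Bundles using (Bijection)
open import Function.Definitions using (Injective)
open import Data.Nat.Primality using (Prime)

IsPrimePower : ℕ → Set
IsPrimePower q = ∃₂ λ p e → Prime p × q ≡ p ℕ.^ suc e

module _ {c ℓ} (R : CommutativeRing c ℓ) where
  open CommutativeRing R hiding (zero)

  IsField : Set (c ⊔ ℓ)
  IsField = ¬ (0# ≈ 1#) × (∀ x → ¬ (x ≈ 0#) → ∃ λ y → x * y ≈ 1#)

  HasOrder : ℕ → Set (c ⊔ ℓ)
  HasOrder q = Bijection setoid (≡.setoid (Fin q))

  Vector : ℕ → Set c
  Vector d = Fin d → Carrier

  _≈ᵥ_ : ∀ {d} → Vector d → Vector d → Set ℓ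
  u ≈ᵥ v = ∀ i → u i ≈ v i

  0ᵥ : ∀ {d} → Vector d
  0ᵥ i = 0#

  _·ᵥ_ : ∀ {d} → Carrier → Vector d → Vector d
  (a ·ᵥ v) i = a * v i

  lincomb : ∀ {k d} → (Fin k → Carrier) → (Fin k → Vector d) → Vector d
  lincomb {zero}  a v i = 0#
  lincomb {suc k} a v i = a zero * v zero i + lincomb (λ j → a (suc j)) (λ j → v (suc j)) i

  InSpan : ∀ {k d} → (Fin k → Vector d) → Vector d → Set (c ⊔ ℓ)
  InSpan v w = ∃ λ a → lincomb a v ≈ᵥ w

  -- Points of PG(n,q) are represented by nonzero vectors of R^(n+1);
  -- two nonzero vectors represent the same point iff they are proportional.
  SamePoint : ∀ {d} → Vector d → Vector d → Set (c ⊔ ℓ)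
  SamePoint u v = ∃ λ a → u ≈ᵥ (a ·ᵥ v)

  IsPointSet : ∀ {k} n → (Fin k → Vector (suc n)) → Set (c ⊔ ℓ)
  IsPointSet n X = (∀ i → ¬ (X i ≈ᵥ 0ᵥ))
                 × (∀ i j → ¬ (i ≡ j) → ¬ SamePoint (X i) (X j))

  SpansPG : ∀ {k} n → (Fin k → Vector (suc n)) → Set (c ⊔ ℓ)
  SpansPG n X = ∀ w → InSpan X w

  OnAPlane : ∀ {m} n → (Fin m → Vector (suc n)) → Set (c ⊔ ℓ)
  OnAPlane n P = ∃ λ (u : Fin 3 → Vector (suc n)) → ∀ j → InSpan u (P j)

  Is4General : ∀ {k} n → (Fin k → Vector (suc n)) → Set (c ⊔ ℓ)
  Is4General {k} n X = IsPointSet n X × SpansPG n X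
    × (∀ (σ : Fin 4 → Fin k) → Injective _≡_ _≡_ σ → ¬ OnAPlane n (λ j → X (σ j)))

  extend : ∀ {k d} → Vector d → (Fin k → Vector d) → Fin (suc k) → Vector d
  extend w X zero    = w
  extend w X (suc i) = X i

  IsComplete4General : ∀ {k} n → (Fin k → Vector (suc n)) → Set (c ⊔ ℓ)
  IsComplete4General n X = Is4General n X
    × (∀ w → ¬ (w ≈ᵥ 0ᵥ) → (∀ i → ¬ SamePoint w (X i)) → ¬ Is4General n (extend w X))

-- The bound  k > ∛(A + C·∛A)/(q-1) + (q-2)/(q-1),
-- A = 6q^(n+1) - q^2 - q,  C = q^2 - 5q + 1,  expressed exactly over ℤ:
-- with M = (q-1)k - (q-2) it is equivalent (q ≥ 2, x ↦ x³ strictly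
-- increasing on ℝ) to  M³ - A > C·∛A,  i.e. to  (M³ - A)³ > C³·A.
boundA : ℕ → ℕ → ℤ
boundA q n = (+ 6) ℤ.* (+ q) ℤ.^ suc n ℤ.- (+ q) ℤ.^ 2 ℤ.- (+ q)

boundC : ℕ → ℤ
boundC q = (+ q) ℤ.^ 2 ℤ.- (+ 5) ℤ.* (+ q) ℤ.+ (+ 1)

boundM : ℕ → ℕ → ℤ
boundM q k = ((+ q) ℤ.- (+ 1)) ℤ.* (+ k) ℤ.- ((+ q) ℤ.- (+ 2))

CubeRootBound : ℕ → ℕ → ℕ → Set
CubeRootBound q n k =
  boundC q ℤ.^ 3 ℤ.* boundA q n ℤ.< (boundM q k ℤ.^ 3 ℤ.- boundA q n) ℤ.^ 3

{-# OPTIONS --safe #-}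
module Submission where

-- Every vector w of F_q^(n+1) is a linear
-- combination of at most three vectors of X: otherwise the point w could be added to X, since four
-- dependent points of the enlarged set would either put w in the span of three points of X or, if w
-- does not take part in the dependency, exhibit three dependent points of X, which lie on a plane
-- together with any fourth point of X.  Counting these combinations gives
-- q^(n+1) ≤ Σ_{i ≤ 3} C(k,i) (q-1)^i.  Six times the right-hand side equals M³ - C·M + q² + q, where
-- M = (q-1)k - (q-2) and C = q² - 5q + 1, so C·M ≤ M³ - A with A = 6q^(n+1) - q² - q; cubing (C is
-- negative exactly for q ∈ {2,3,4}) gives C³·A < (M³ - A)³, the bound expressed by CubeRootBound.

open import Defs
open import Level using (_⊔_)
open import Algebra.Bundles using (CommutativeRing)
open import Data.Nat as ℕ using (ℕ; zero; suc; z≤n; s≤s)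
import Data.Nat.Properties as ℕ
open import Data.Nat.Primality using (prime⇒nonZero; prime⇒nonTrivial)
open import Data.Fin as Fin using (Fin; zero; suc; punchIn; punchOut)
import Data.Fin.Properties as Fin
open import Data.Empty using (⊥)
open import Data.Unit using (⊤; tt)
open import Data.Product using (∃; ∃₂; _×_; _,_; proj₁; proj₂)
open import Data.Product.Function.NonDependent.Propositional using (_×-↔_)
open import Data.Sum using (_⊎_; inj₁; inj₂)
open import Data.Sum.Function.Propositional using (_⊎-↔_)
open import Data.Vec.Functional using (_∷_; tail; removeAt; insertAt)
open import Data.Vec.Functional.Properties using (insertAt-lookup; insertAt-punchIn; removeAt-punchOut)
open import Function.Base using (_∘_; id)
open import Function.Bundles using (Bijection; Inverse; _↔_)
open import Function.Definitions using (Injective)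
open import Function.Properties.Bijection using (Bijection⇒Inverse)
open import Function.Properties.Inverse using (↔-refl; ↔-sym; ↔-trans)
open import Relation.Binary.Definitions using (Decidable)
open import Relation.Binary.PropositionalEquality as ≡ using (_≡_; _≢_)
open import Relation.Nullary using (¬_; Dec; yes; no; ¬?; map′; contradiction)
open import Relation.Nullary.Decidable using (decidable-stable)

-- sparseCount p k r = Σ_{i ≤ r} C(k,i) pⁱ, the number of vectors of F^k with at most r nonzero
-- entries when |F| = p + 1.
sparseCount : ℕ → ℕ → ℕ → ℕ
sparseCount p zero    r       = 1
sparseCount p (suc k) zero    = sparseCount p k zero
sparseCount p (suc k) (suc r) = sparseCount p k (suc r) ℕ.+ p ℕ.* sparseCount p k r

module CubicBound where
  open import Data.Integer as ℤ
    using (+_; -[1+_]; +[1+_]; +0; 0ℤ; 1ℤ; _+_; _-_; _*_; -_; _^_; _≤_; _<_; +≤+; +<+; -≤+; -≤-; -<+)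
  import Data.Integer.Properties as ℤ
  open import Data.Integer.Tactic.RingSolver using (solve-∀)
  import Data.Nat.Tactic.RingSolver as ℕ
  open import Data.Empty using (⊥-elim)
  open import Relation.Binary.PropositionalEquality
    using (refl; sym; trans; cong; cong₂; subst; subst₂; module ≡-Reasoning)

  pos-^ : ∀ m e → (+ m) ^ e ≡ + (m ℕ.^ e)
  pos-^ m zero    = refl
  pos-^ m (suc e) = trans (cong (+ m *_) (pos-^ m e)) (sym (ℤ.pos-* m (m ℕ.^ e)))

  sparseCount-recurrence : ∀ p k r →
    + sparseCount p (suc k) (suc r) ≡ + sparseCount p k (suc r) + + p * + sparseCount p k r
  sparseCount-recurrence p k r = cong (λ x → + sparseCount p k (suc r) + x) (ℤ.pos-* p (sparseCount p k r))

  sparseCount-0 : ∀ p k → sparseCount p k 0 ≡ 1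
  sparseCount-0 p zero    = refl
  sparseCount-0 p (suc k) = sparseCount-0 p k

  sparseCount-1 : ∀ p k → + sparseCount p k 1 ≡ 1ℤ + + k * + p
  sparseCount-1 p zero    = refl
  sparseCount-1 p (suc k) = begin
    + sparseCount p (suc k) 1                        ≡⟨ sparseCount-recurrence p k 0 ⟩
    + sparseCount p k 1 + + p * + sparseCount p k 0
      ≡⟨ cong₂ (λ x y → x + + p * + y) (sparseCount-1 p k) (sparseCount-0 p k) ⟩
    1ℤ + + k * + p + + p * 1ℤ                        ≡⟨ step (+ k) (+ p) ⟩
    1ℤ + + suc k * + p                               ∎
    where
    open ≡-Reasoning
    step : ∀ K P → 1ℤ + K * P + P * 1ℤ ≡ 1ℤ + (1ℤ + K) * P
    step = solve-∀

  sparseCount-2 : ∀ p k →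
    + 2 * + sparseCount p k 2 ≡ + 2 + + 2 * + k * + p + + k * (+ k - 1ℤ) * (+ p * + p)
  sparseCount-2 p zero    = refl
  sparseCount-2 p (suc k) = begin
    + 2 * + sparseCount p (suc k) 2                          ≡⟨ cong (+ 2 *_) (sparseCount-recurrence p k 1) ⟩
    + 2 * (+ sparseCount p k 2 + + p * + sparseCount p k 1)
      ≡⟨ distrib (+ sparseCount p k 2) (+ sparseCount p k 1) (+ p) ⟩
    + 2 * + sparseCount p k 2 + + 2 * + p * + sparseCount p k 1
      ≡⟨ cong₂ (λ x y → x + + 2 * + p * y) (sparseCount-2 p k) (sparseCount-1 p k) ⟩
    + 2 + + 2 * + k * + p + + k * (+ k - 1ℤ) * (+ p * + p) + + 2 * + p * (1ℤ + + k * + p)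
      ≡⟨ step (+ k) (+ p) ⟩
    + 2 + + 2 * + suc k * + p + + suc k * (+ suc k - 1ℤ) * (+ p * + p) ∎
    where
    open ≡-Reasoning
    distrib : ∀ x y P → + 2 * (x + P * y) ≡ + 2 * x + + 2 * P * y
    distrib = solve-∀
    step : ∀ K P → + 2 + + 2 * K * P + K * (K - 1ℤ) * (P * P) + + 2 * P * (1ℤ + K * P)
                 ≡ + 2 + + 2 * (1ℤ + K) * P + (1ℤ + K) * ((1ℤ + K) - 1ℤ) * (P * P)
    step = solve-∀

  sparseCount-3 : ∀ p k → + 6 * + sparseCount p k 3
    ≡ + 6 + + 6 * + k * + p + + 3 * + k * (+ k - 1ℤ) * (+ p * + p)
      + + k * (+ k - 1ℤ) * (+ k - + 2) * (+ p * (+ p * + p))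
  sparseCount-3 p zero    = refl
  sparseCount-3 p (suc k) = begin
    + 6 * + sparseCount p (suc k) 3                          ≡⟨ cong (+ 6 *_) (sparseCount-recurrence p k 2) ⟩
    + 6 * (+ sparseCount p k 3 + + p * + sparseCount p k 2)
      ≡⟨ distrib (+ sparseCount p k 3) (+ sparseCount p k 2) (+ p) ⟩
    + 6 * + sparseCount p k 3 + + 3 * + p * (+ 2 * + sparseCount p k 2)
      ≡⟨ cong₂ (λ x y → x + + 3 * + p * y) (sparseCount-3 p k) (sparseCount-2 p k) ⟩
    + 6 + + 6 * + k * + p + + 3 * + k * (+ k - 1ℤ) * (+ p * + p)
      + + k * (+ k - 1ℤ) * (+ k - + 2) * (+ p * (+ p * + p))
      + + 3 * + p * (+ 2 + + 2 * + k * + p + + k * (+ k - 1ℤ) * (+ p * + p))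
      ≡⟨ step (+ k) (+ p) ⟩
    + 6 + + 6 * + suc k * + p + + 3 * + suc k * (+ suc k - 1ℤ) * (+ p * + p)
      + + suc k * (+ suc k - 1ℤ) * (+ suc k - + 2) * (+ p * (+ p * + p)) ∎
    where
    open ≡-Reasoning
    distrib : ∀ x y P → + 6 * (x + P * y) ≡ + 6 * x + + 3 * P * (+ 2 * y)
    distrib = solve-∀
    step : ∀ K P → + 6 + + 6 * K * P + + 3 * K * (K - 1ℤ) * (P * P) + K * (K - 1ℤ) * (K - + 2) * (P * (P * P))
                   + + 3 * P * (+ 2 + + 2 * K * P + K * (K - 1ℤ) * (P * P))
                 ≡ + 6 + + 6 * (1ℤ + K) * P + + 3 * (1ℤ + K) * ((1ℤ + K) - 1ℤ) * (P * P)
                   + (1ℤ + K) * ((1ℤ + K) - 1ℤ) * ((1ℤ + K) - + 2) * (P * (P * P))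
    step = solve-∀

  sparseCount-3-cubic : ∀ p k → + 6 * + sparseCount p k 3
    ≡ boundM (suc p) k ^ 3 - boundC (suc p) * boundM (suc p) k + (+ suc p) ^ 2 + + suc p
  sparseCount-3-cubic p k = trans (sparseCount-3 p k) (cubic (+ k) (+ p))
    where
    cubic : ∀ K P → let Q = 1ℤ + P ; M = (Q - 1ℤ) * K - (Q - + 2) in
      + 6 + + 6 * K * P + + 3 * K * (K - 1ℤ) * (P * P) + K * (K - 1ℤ) * (K - + 2) * (P * (P * P))
      ≡ M * (M * (M * 1ℤ)) - (Q * (Q * 1ℤ) - + 5 * Q + 1ℤ) * M + Q * (Q * 1ℤ) + Q
    cubic = solve-∀

  ^3-neg : ∀ i → (- i) ^ 3 ≡ - (i ^ 3)
  ^3-neg = cube-identity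
    where
    cube-identity : ∀ i → (- i) * ((- i) * ((- i) * 1ℤ)) ≡ - (i * (i * (i * 1ℤ)))
    cube-identity = solve-∀

  ^3-mono-≤ : ∀ {i j} → i ≤ j → i ^ 3 ≤ j ^ 3
  ^3-mono-≤ (+≤+ {m} {n} m≤n) =
    subst₂ _≤_ (sym (pos-^ m 3)) (sym (pos-^ n 3)) (+≤+ (ℕ.^-monoˡ-≤ 3 m≤n))
  ^3-mono-≤ (-≤+ {m} {n}) =
    subst₂ _≤_ (sym (trans (^3-neg +[1+ m ]) (cong -_ (pos-^ (suc m) 3)))) (sym (pos-^ n 3)) ℤ.neg-≤-pos
  ^3-mono-≤ (-≤- {m} {n} n≤m) =
    subst₂ _≤_ (sym (^3-neg +[1+ m ])) (sym (^3-neg +[1+ n ])) (ℤ.neg-mono-≤ (^3-mono-≤ (+≤+ (s≤s n≤m))))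

  x-y<x : ∀ x {y} → 0ℤ < y → x - y < x
  x-y<x x 0<y = subst (x - _ <_) (ℤ.+-identityʳ x) (ℤ.+-monoʳ-< x (ℤ.neg-mono-< 0<y))

  0<j-i : ∀ {i j} → i < j → 0ℤ < j - i
  0<j-i {i} {j} i<j = subst (_< j - i) (ℤ.+-inverseʳ i) (ℤ.+-monoˡ-< (- i) i<j)

  cube-gap-of-sign : ∀ {C M A B} → 0ℤ < C ^ 3 * B → B ≡ M ^ 3 - A → C * M ≤ B → C ^ 3 * A < B ^ 3
  cube-gap-of-sign {C} {M} {A} {B} 0<C³B refl CM≤B = begin-strict
    C ^ 3 * A                  ≡⟨ identity C M A ⟩
    (C * M) ^ 3 - C ^ 3 * B    <⟨ x-y<x ((C * M) ^ 3) 0<C³B ⟩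
    (C * M) ^ 3                ≤⟨ ^3-mono-≤ CM≤B ⟩
    B ^ 3                      ∎
    where
    open ℤ.≤-Reasoning
    identity : ∀ C M A → C * (C * (C * 1ℤ)) * A
      ≡ (C * M) * ((C * M) * ((C * M) * 1ℤ)) - C * (C * (C * 1ℤ)) * (M * (M * (M * 1ℤ)) - A)
    identity = solve-∀

  -- C³·B > 0 unless C < 0 ≤ B, and in that case C³·A < 0 ≤ B³.
  cube-gap : ∀ {C M A B} → C ≢ 0ℤ → 0ℤ < M → 0ℤ < A → B ≡ M ^ 3 - A → C * M ≤ B → C ^ 3 * A < B ^ 3
  cube-gap {+0} C≢0 _ _ _ _ = ⊥-elim (C≢0 refl)
  cube-gap {+[1+ c ]} {+0} _ (+<+ ())
  cube-gap {+[1+ c ]} {+[1+ m ]} {B = +0} _ _ _ _ (+≤+ ())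
  cube-gap {+[1+ c ]} {+[1+ m ]} {B = -[1+ b ]} _ _ _ _ ()
  cube-gap {C@(+[1+ c ])} {M@(+[1+ m ])} {A} {B@(+[1+ b ])} _ _ _ B≡ CM≤B =
    cube-gap-of-sign {C} {M} {A} {B} (+<+ (s≤s z≤n)) B≡ CM≤B
  cube-gap {C@(-[1+ c ])} {M} {A} {B@(-[1+ b ])} _ _ _ B≡ CM≤B =
    cube-gap-of-sign {C} {M} {A} {B} (+<+ (s≤s z≤n)) B≡ CM≤B
  cube-gap { -[1+ c ]} {A = +0} {B = + b} _ _ (+<+ ())
  cube-gap { -[1+ c ]} {A = +[1+ a ]} {B = + b} _ _ _ _ _ =
    ℤ.<-≤-trans -<+ (subst (0ℤ ≤_) (sym (pos-^ b 3)) (+≤+ z≤n))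

  sparseCount-bound⇒C*M≤M³-A : ∀ p n k → suc p ℕ.^ suc n ℕ.≤ sparseCount p k 3 →
    boundC (suc p) * boundM (suc p) k ≤ boundM (suc p) k ^ 3 - boundA (suc p) n
  sparseCount-bound⇒C*M≤M³-A p n k q^[n+1]≤N =
    ℤ.0≤i-j⇒j≤i (subst (0ℤ ≤_) difference (ℤ.i≤j⇒0≤j-i six-bound))
    where
    Q = + suc p
    six-bound : + 6 * Q ^ suc n ≤ + 6 * + sparseCount p k 3
    six-bound = ℤ.*-monoˡ-≤-nonNeg (+ 6)
      (subst (_≤ + sparseCount p k 3) (sym (pos-^ (suc p) (suc n))) (+≤+ q^[n+1]≤N))
    rearrange : ∀ M C Q X → (M * (M * (M * 1ℤ)) - C * M + Q * (Q * 1ℤ) + Q) - + 6 * X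
      ≡ (M * (M * (M * 1ℤ)) - (+ 6 * X - Q * (Q * 1ℤ) - Q)) - C * M
    rearrange = solve-∀
    difference : + 6 * + sparseCount p k 3 - + 6 * Q ^ suc n
      ≡ (boundM (suc p) k ^ 3 - boundA (suc p) n) - boundC (suc p) * boundM (suc p) k
    difference = trans (cong (_- + 6 * Q ^ suc n) (sparseCount-3-cubic p k))
                       (rearrange (boundM (suc p) k) (boundC (suc p)) Q (Q ^ suc n))

  boundC≢0 : ∀ q → boundC q ≢ 0ℤ
  boundC≢0 0 ()
  boundC≢0 1 ()
  boundC≢0 2 ()
  boundC≢0 3 ()
  boundC≢0 4 ()
  boundC≢0 q@(suc (suc (suc (suc (suc t))))) C≡0 = +[1+n]≢0 (trans (sym C≡1+q*t) C≡0)
    where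
    +[1+n]≢0 : +[1+ q ℕ.* t ] ≢ 0ℤ
    +[1+n]≢0 ()
    identity : ∀ T → (+ 5 + T) * ((+ 5 + T) * 1ℤ) - + 5 * (+ 5 + T) + 1ℤ ≡ 1ℤ + (+ 5 + T) * T
    identity = solve-∀
    C≡1+q*t : boundC q ≡ +[1+ q ℕ.* t ]
    C≡1+q*t = trans (identity (+ t)) (cong (_+_ 1ℤ) (sym (ℤ.pos-* q t)))

  0<boundM : ∀ p k → 0ℤ < boundM (suc p) (suc k)
  0<boundM p k = subst (0ℤ <_) (sym M≡1+p*k) (+<+ (s≤s z≤n))
    where
    identity : ∀ P K → ((1ℤ + P) - 1ℤ) * (1ℤ + K) - ((1ℤ + P) - + 2) ≡ 1ℤ + P * K
    identity = solve-∀
    M≡1+p*k : boundM (suc p) (suc k) ≡ +[1+ p ℕ.* k ]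
    M≡1+p*k = trans (identity (+ p) (+ k)) (cong (_+_ 1ℤ) (sym (ℤ.pos-* p k)))

  q²+q<6q^[n+1] : ∀ p n → 1 ℕ.≤ n → suc p ℕ.^ 2 ℕ.+ suc p ℕ.< 6 ℕ.* suc p ℕ.^ suc n
  q²+q<6q^[n+1] p n 1≤n = begin-strict
    q ℕ.^ 2 ℕ.+ q          ≤⟨ ℕ.+-mono-≤ q²≤X (ℕ.≤-trans (ℕ.m≤m*n q (q ℕ.* 1)) q²≤X) ⟩
    X ℕ.+ X                <⟨ ℕ.m<m+n (X ℕ.+ X) (ℕ.<-≤-trans (ℕ.m^n>0 q (suc n)) (ℕ.m≤n*m X 4)) ⟩
    X ℕ.+ X ℕ.+ 4 ℕ.* X    ≡⟨ six X ⟩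
    6 ℕ.* X                ∎
    where
    open ℕ.≤-Reasoning
    q = suc p
    X = q ℕ.^ suc n
    q²≤X : q ℕ.^ 2 ℕ.≤ X
    q²≤X = ℕ.^-monoʳ-≤ q (s≤s 1≤n)
    six : ∀ x → x ℕ.+ x ℕ.+ 4 ℕ.* x ≡ 6 ℕ.* x
    six = ℕ.solve-∀

  0<boundA : ∀ p n → 1 ℕ.≤ n → 0ℤ < boundA (suc p) n
  0<boundA p n 1≤n = subst (0ℤ <_) (sym A≡) (0<j-i (+<+ (q²+q<6q^[n+1] p n 1≤n)))
    where
    open ≡-Reasoning
    q = suc p
    regroup : ∀ a b c → a - b - c ≡ a - (b + c)
    regroup = solve-∀
    A≡ : boundA q n ≡ + (6 ℕ.* q ℕ.^ suc n) - + (q ℕ.^ 2 ℕ.+ q)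
    A≡ = begin
      + 6 * (+ q) ^ suc n - (+ q) ^ 2 - + q
        ≡⟨ cong₂ (λ x y → + 6 * x - y - + q) (pos-^ q (suc n)) (pos-^ q 2) ⟩
      + 6 * + (q ℕ.^ suc n) - + (q ℕ.^ 2) - + q
        ≡⟨ regroup (+ 6 * + (q ℕ.^ suc n)) (+ (q ℕ.^ 2)) (+ q) ⟩
      + 6 * + (q ℕ.^ suc n) - (+ (q ℕ.^ 2) + + q)
        ≡⟨ cong₂ _-_ (sym (ℤ.pos-* 6 (q ℕ.^ suc n))) (sym (ℤ.pos-+ (q ℕ.^ 2) q)) ⟩
      + (6 ℕ.* q ℕ.^ suc n) - + (q ℕ.^ 2 ℕ.+ q) ∎

  cubeRootBound-of-sparseCount : ∀ p n k → 1 ℕ.≤ p → 1 ℕ.≤ n →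
    suc p ℕ.^ suc n ℕ.≤ sparseCount p k 3 → CubeRootBound (suc p) n k
  cubeRootBound-of-sparseCount p n zero 1≤p _ q^[n+1]≤1
    with ℕ.≤-trans (ℕ.*-mono-≤ (s≤s 1≤p) (ℕ.m^n>0 (suc p) n)) q^[n+1]≤1
  ... | s≤s ()
  cubeRootBound-of-sparseCount p n (suc k) _ 1≤n q^[n+1]≤N =
    cube-gap (boundC≢0 (suc p)) (0<boundM p k) (0<boundA p n 1≤n) refl
             (sparseCount-bound⇒C*M≤M³-A p n (suc k) q^[n+1]≤N)

open CubicBound using (cubeRootBound-of-sparseCount)
open import Data.Nat using (_≤_; _<_)

funToFin-cong : ∀ {m n} {f g : Fin m → Fin n} → (∀ i → f i ≡ g i) → Fin.funToFin f ≡ Fin.funToFin g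
funToFin-cong {zero}  f≗g = ≡.refl
funToFin-cong {suc m} f≗g = ≡.cong₂ Fin.combine (f≗g zero) (funToFin-cong (f≗g ∘ suc))

∃∉image : ∀ {m n} → m < n → (f : Fin m → Fin n) → ∃ λ t → ∀ i → f i ≢ t
∃∉image {n = n} m<n f
  with Fin.¬∀⟶∃¬ n (λ t → ∃ λ i → f i ≡ t) (λ t → Fin.any? λ i → f i Fin.≟ t) f-not-surjective
  where
  f-not-surjective : ¬ (∀ t → ∃ λ i → f i ≡ t)
  f-not-surjective surjective = ℕ.<⇒≱ m<n (Fin.injective⇒≤ {f = g} g-injective)
    where
    g = λ t → proj₁ (surjective t)
    g-injective : ∀ {s t} → g s ≡ g t → s ≡ t
    g-injective {s} {t} gs≡gt =
      ≡.trans (≡.sym (proj₂ (surjective s))) (≡.trans (≡.cong f gs≡gt) (proj₂ (surjective t)))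
... | t , t∉ = t , λ i fi≡t → t∉ (i , fi≡t)

module LinearAlgebra {c ℓ} (F : CommutativeRing c ℓ) where
  open CommutativeRing F hiding (zero)
  open import Algebra.Properties.Semiring.Sum semiring using
    (sum; sum-cong-≋; sum-cong-≗; sum-remove; sum-replicate-zero; ∑-distrib-+; ∑-comm; *-distribˡ-sum; *-distribʳ-sum)
  open import Relation.Binary.Reasoning.Setoid setoid

  infix 4 _≋_
  _≋_ : ∀ {d} → Vector F d → Vector F d → Set ℓ
  _≋_ = _≈ᵥ_ F

  lincomb≡sum : ∀ {m d} (a : Fin m → Carrier) (v : Fin m → Vector F d) e →
                lincomb F a v e ≡ sum (λ i → a i * v i e)
  lincomb≡sum {zero}  a v e = ≡.refl
  lincomb≡sum {suc m} a v e =
    ≡.cong (a zero * v zero e +_) (lincomb≡sum (λ i → a (suc i)) (λ i → v (suc i)) e)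

  lincomb-cong : ∀ {m d d′} {a b : Fin m → Carrier} {v : Fin m → Vector F d} {w : Fin m → Vector F d′} {e e′} →
                 (∀ i → a i ≈ b i) → (∀ i → v i e ≈ w i e′) → lincomb F a v e ≈ lincomb F b w e′
  lincomb-cong {a = a} {b} {v} {w} {e} {e′} a≈b v≈w = begin
    lincomb F a v e            ≡⟨ lincomb≡sum a v e ⟩
    sum (λ i → a i * v i e)    ≈⟨ sum-cong-≋ (λ i → *-cong (a≈b i) (v≈w i)) ⟩
    sum (λ i → b i * w i e′)   ≡⟨ lincomb≡sum b w e′ ⟨
    lincomb F b w e′           ∎

  lincomb-zero : ∀ {m d} {a : Fin m → Carrier} {v : Fin m → Vector F d} {e} →
                 (∀ i → a i * v i e ≈ 0#) → lincomb F a v e ≈ 0#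
  lincomb-zero {m} {a = a} {v} {e} terms≈0 = begin
    lincomb F a v e            ≡⟨ lincomb≡sum a v e ⟩
    sum (λ i → a i * v i e)    ≈⟨ sum-cong-≋ terms≈0 ⟩
    sum {m} (λ _ → 0#)         ≈⟨ sum-replicate-zero m ⟩
    0#                         ∎

  lincomb-+ : ∀ {m d} (a b : Fin m → Carrier) (v : Fin m → Vector F d) e →
    lincomb F (λ i → a i + b i) v e ≈ lincomb F a v e + lincomb F b v e
  lincomb-+ a b v e = begin
    lincomb F (λ i → a i + b i) v e                      ≡⟨ lincomb≡sum (λ i → a i + b i) v e ⟩
    sum (λ i → (a i + b i) * v i e)                      ≈⟨ sum-cong-≋ (λ i → distribʳ (v i e) (a i) (b i)) ⟩
    sum (λ i → a i * v i e + b i * v i e)                ≈⟨ ∑-distrib-+ (λ i → a i * v i e) (λ i → b i * v i e) ⟩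
    sum (λ i → a i * v i e) + sum (λ i → b i * v i e)    ≡⟨ ≡.cong₂ _+_ (lincomb≡sum a v e) (lincomb≡sum b v e) ⟨
    lincomb F a v e + lincomb F b v e                    ∎

  *-lincomb : ∀ {m d} x (a : Fin m → Carrier) (v : Fin m → Vector F d) e →
              x * lincomb F a v e ≈ lincomb F (λ i → x * a i) v e
  *-lincomb x a v e = begin
    x * lincomb F a v e              ≡⟨ ≡.cong (x *_) (lincomb≡sum a v e) ⟩
    x * sum (λ i → a i * v i e)      ≈⟨ *-distribˡ-sum x (λ i → a i * v i e) ⟩
    sum (λ i → x * (a i * v i e))    ≈⟨ sum-cong-≋ (λ i → sym (*-assoc x (a i) (v i e))) ⟩
    sum (λ i → x * a i * v i e)      ≡⟨ lincomb≡sum (λ i → x * a i) v e ⟨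
    lincomb F (λ i → x * a i) v e    ∎

  lincomb-removeAt : ∀ {m d} (a : Fin (suc m) → Carrier) (v : Fin (suc m) → Vector F d) j e →
    lincomb F a v e ≈ a j * v j e + lincomb F (removeAt a j) (removeAt v j) e
  lincomb-removeAt a v j e = begin
    lincomb F a v e                                                ≡⟨ lincomb≡sum a v e ⟩
    sum (λ i → a i * v i e)                                        ≈⟨ sum-remove {i = j} (λ i → a i * v i e) ⟩
    a j * v j e + sum (λ i → a (punchIn j i) * v (punchIn j i) e)
      ≡⟨ ≡.cong (a j * v j e +_) (lincomb≡sum (removeAt a j) (removeAt v j) e) ⟨
    a j * v j e + lincomb F (removeAt a j) (removeAt v j) e        ∎

  lincomb-insertAt : ∀ {m d} (b : Fin m → Carrier) j x (v : Fin (suc m) → Vector F d) e →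
    lincomb F (insertAt b j x) v e ≈ x * v j e + lincomb F b (removeAt v j) e
  lincomb-insertAt b j x v e = trans (lincomb-removeAt (insertAt b j x) v j e)
    (+-cong (*-congʳ (reflexive (insertAt-lookup b j x)))
            (lincomb-cong (λ i → reflexive (insertAt-punchIn b j x i)) (λ _ → refl)))

  single : ∀ {m} → Fin m → Carrier → Fin m → Carrier
  single {suc _} j x = insertAt (λ _ → 0#) j x

  lincomb-single : ∀ {m d} j x (v : Fin m → Vector F d) e → lincomb F (single j x) v e ≈ x * v j e
  lincomb-single {suc _} j x v e = begin
    lincomb F (single j x) v e                           ≈⟨ lincomb-insertAt (λ _ → 0#) j x v e ⟩
    x * v j e + lincomb F (λ _ → 0#) (removeAt v j) e    ≈⟨ +-congˡ (lincomb-zero (λ i → zeroˡ (removeAt v j i e))) ⟩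
    x * v j e + 0#                                       ≈⟨ +-identityʳ (x * v j e) ⟩
    x * v j e                                            ∎

  inSpan-member : ∀ {m d} (u : Fin m → Vector F d) j → InSpan F u (u j)
  inSpan-member u j = single j 1# , λ e → trans (lincomb-single j 1# u e) (*-identityˡ (u j e))

  inSpan-resp : ∀ {m d} {u u′ : Fin m → Vector F d} {w w′} → (∀ i → u i ≋ u′ i) → w ≋ w′ →
                InSpan F u w → InSpan F u′ w′
  inSpan-resp u≋u′ w≋w′ (a , Σ≋w) =
    a , λ e → trans (lincomb-cong (λ _ → refl) (λ i → sym (u≋u′ i e))) (trans (Σ≋w e) (w≋w′ e))

  SpannedBy≤ : ∀ {k d} → ℕ → (Fin k → Vector F d) → Vector F d → Set (c ⊔ ℓ)
  SpannedBy≤ {k} r X w = ∃ λ m → m ≤ r × ∃ λ (τ : Fin m → Fin k) → InSpan F (λ i → X (τ i)) w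

  pushforward : ∀ {m k} → (Fin m → Fin k) → (Fin m → Carrier) → Fin k → Carrier
  pushforward {zero}  τ c t = 0#
  pushforward {suc m} τ c t = single (τ zero) (c zero) t + pushforward (τ ∘ suc) (c ∘ suc) t

  lincomb-pushforward : ∀ {m k d} (τ : Fin m → Fin k) c (X : Fin k → Vector F d) e →
    lincomb F (pushforward τ c) X e ≈ lincomb F c (λ i → X (τ i)) e
  lincomb-pushforward {zero}  τ c X e = lincomb-zero (λ t → zeroˡ (X t e))
  lincomb-pushforward {suc m} τ c X e = begin
    lincomb F (pushforward τ c) X e
      ≈⟨ lincomb-+ (single (τ zero) (c zero)) (pushforward (τ ∘ suc) (c ∘ suc)) X e ⟩
    lincomb F (single (τ zero) (c zero)) X e + lincomb F (pushforward (τ ∘ suc) (c ∘ suc)) X e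
      ≈⟨ +-cong (lincomb-single (τ zero) (c zero) X e) (lincomb-pushforward (τ ∘ suc) (c ∘ suc) X e) ⟩
    lincomb F c (λ i → X (τ i)) e ∎

  LinearlyDependent : ∀ {m d} → (Fin m → Vector F d) → Set (c ⊔ ℓ)
  LinearlyDependent v = ∃ λ a → (∃ λ i → ¬ a i ≈ 0#) × lincomb F a v ≋ 0ᵥ F

  dependent-resp : ∀ {m d} {v w : Fin m → Vector F d} → (∀ i → v i ≋ w i) →
                   LinearlyDependent v → LinearlyDependent w
  dependent-resp v≋w (a , nontrivial , Σ≈0) =
    a , nontrivial , λ e → trans (lincomb-cong (λ _ → refl) (λ i → sym (v≋w i e))) (Σ≈0 e)

  dependent-∷ : ∀ {m d} (u : Vector F d) {v : Fin m → Vector F d} →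
                LinearlyDependent v → LinearlyDependent (u ∷ v)
  dependent-∷ u (a , (i , aᵢ≉0) , Σ≈0) =
    0# ∷ a , (suc i , aᵢ≉0) , λ e → trans (+-cong (zeroˡ (u e)) (Σ≈0 e)) (+-identityʳ 0#)

  dependent-removeAt : ∀ {m d} {v : Fin (suc m) → Vector F d} {a} j → a j ≈ 0# →
    (∃ λ i → ¬ a i ≈ 0#) → lincomb F a v ≋ 0ᵥ F → LinearlyDependent (removeAt v j)
  dependent-removeAt {v = v} {a} j aⱼ≈0 (i , aᵢ≉0) Σ≈0 with j Fin.≟ i
  ... | yes ≡.refl = contradiction aⱼ≈0 aᵢ≉0
  ... | no j≢i = removeAt a j , (punchOut j≢i , aᵢ≉0 ∘ trans (reflexive (≡.sym (removeAt-punchOut a j≢i)))) ,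
    λ e → begin
      lincomb F (removeAt a j) (removeAt v j) e                ≈⟨ +-identityˡ _ ⟨
      0# + lincomb F (removeAt a j) (removeAt v j) e
        ≈⟨ +-congʳ (trans (sym (zeroˡ (v j e))) (*-congʳ (sym aⱼ≈0))) ⟩
      a j * v j e + lincomb F (removeAt a j) (removeAt v j) e  ≈⟨ lincomb-removeAt a v j e ⟨
      lincomb F a v e                                          ≈⟨ Σ≈0 e ⟩
      0#                                                       ∎

  eliminate : ∀ {m d} → Fin (suc m) → (Fin m → Carrier) → (Fin (suc m) → Vector F d) → Fin m → Vector F d
  eliminate j ρ v i e = v (punchIn j i) e + ρ i * v j e

  lincomb-eliminate : ∀ {m d} (b : Fin m → Carrier) j ρ (v : Fin (suc m) → Vector F d) e →
    lincomb F b (eliminate j ρ v) e ≈ sum (λ i → b i * ρ i) * v j e + lincomb F b (removeAt v j) e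
  lincomb-eliminate b j ρ v e = begin
    lincomb F b (eliminate j ρ v) e                                 ≡⟨ lincomb≡sum b (eliminate j ρ v) e ⟩
    sum (λ i → b i * (v (punchIn j i) e + ρ i * v j e))
      ≈⟨ sum-cong-≋ (λ i → trans (distribˡ (b i) _ _) (+-congˡ (sym (*-assoc (b i) (ρ i) (v j e))))) ⟩
    sum (λ i → b i * v (punchIn j i) e + b i * ρ i * v j e)        ≈⟨ ∑-distrib-+ _ (λ i → b i * ρ i * v j e) ⟩
    sum (λ i → b i * v (punchIn j i) e) + sum (λ i → b i * ρ i * v j e)
      ≈⟨ +-cong (reflexive (≡.sym (lincomb≡sum b (removeAt v j) e)))
                (sym (*-distribʳ-sum (v j e) (λ i → b i * ρ i))) ⟩
    lincomb F b (removeAt v j) e + sum (λ i → b i * ρ i) * v j e   ≈⟨ +-comm _ _ ⟩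
    sum (λ i → b i * ρ i) * v j e + lincomb F b (removeAt v j) e   ∎

  dependent-of-eliminated : ∀ {m d} j ρ (v : Fin (suc m) → Vector F d) →
    LinearlyDependent (eliminate j ρ v) → LinearlyDependent v
  dependent-of-eliminated j ρ v (b , (i , bᵢ≉0) , Σb≈0) = a , (punchIn j i , aₚᵢ≉0) , Σa≈0
    where
    a = insertAt b j (sum (λ i → b i * ρ i))
    aₚᵢ≉0 : ¬ a (punchIn j i) ≈ 0#
    aₚᵢ≉0 = bᵢ≉0 ∘ trans (reflexive (≡.sym (insertAt-punchIn b j _ i)))
    Σa≈0 : lincomb F a v ≋ 0ᵥ F
    Σa≈0 e = begin
      lincomb F a v e                                               ≈⟨ lincomb-insertAt b j _ v e ⟩
      sum (λ i → b i * ρ i) * v j e + lincomb F b (removeAt v j) e  ≈⟨ lincomb-eliminate b j ρ v e ⟨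
      lincomb F b (eliminate j ρ v) e                               ≈⟨ Σb≈0 e ⟩
      0#                                                            ∎

  dependent-of-tails : ∀ {m d} (v : Fin m → Vector F (suc d)) → (∀ i → v i zero ≈ 0#) →
    LinearlyDependent (λ i → tail (v i)) → LinearlyDependent v
  dependent-of-tails v column≈0 (a , nontrivial , Σ≈0) = a , nontrivial , Σa≈0
    where
    Σa≈0 : lincomb F a v ≋ 0ᵥ F
    Σa≈0 zero    = lincomb-zero (λ i → trans (*-congˡ (column≈0 i)) (zeroʳ (a i)))
    Σa≈0 (suc e) = trans (lincomb-cong {v = v} {w = λ i → tail (v i)} {e = suc e} (λ _ → refl) (λ _ → refl)) (Σ≈0 e)

  dependent-of-coordinates : ∀ {n m d} (cs : Fin n → Vector F m) (u : Fin m → Vector F d) (y : Fin n → Vector F d) →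
    (∀ j → lincomb F (cs j) u ≋ y j) → LinearlyDependent cs → LinearlyDependent y
  dependent-of-coordinates {m = m} cs u y y≋ (a , nontrivial , Σ≈0) = a , nontrivial , Σa≈0
    where
    Σa≈0 : lincomb F a y ≋ 0ᵥ F
    Σa≈0 e = begin
      lincomb F a y e                                 ≡⟨ lincomb≡sum a y e ⟩
      sum (λ j → a j * y j e)                         ≈⟨ sum-cong-≋ (λ j → *-congˡ (sym (y≋ j e))) ⟩
      sum (λ j → a j * lincomb F (cs j) u e)          ≈⟨ sum-cong-≋ (λ j → *-lincomb (a j) (cs j) u e) ⟩
      sum (λ j → lincomb F (λ t → a j * cs j t) u e)  ≡⟨ sum-cong-≗ (λ j → lincomb≡sum (λ t → a j * cs j t) u e) ⟩
      sum (λ j → sum (λ t → a j * cs j t * u t e))    ≈⟨ ∑-comm (λ j t → a j * cs j t * u t e) ⟩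
      sum (λ t → sum (λ j → a j * cs j t * u t e))
        ≈⟨ sum-cong-≋ (λ t → sym (*-distribʳ-sum (u t e) (λ j → a j * cs j t))) ⟩
      sum (λ t → sum (λ j → a j * cs j t) * u t e)
        ≈⟨ sum-cong-≋ (λ t → *-congʳ (reflexive (≡.sym (lincomb≡sum a cs t)))) ⟩
      sum (λ t → lincomb F a cs t * u t e)            ≈⟨ sum-cong-≋ (λ t → trans (*-congʳ (Σ≈0 t)) (zeroˡ (u t e))) ⟩
      sum {m} (λ _ → 0#)                              ≈⟨ sum-replicate-zero m ⟩
      0#                                              ∎

module LinearAlgebraOverField {c ℓ} (F : CommutativeRing c ℓ) (isField : IsField F)
                              (_≟_ : Decidable (CommutativeRing._≈_ F)) where
  open CommutativeRing F hiding (zero)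
  open LinearAlgebra F
  open import Algebra.Properties.Ring ring using (-‿distribˡ-*; -‿distribʳ-*; +-inverseˡ-unique)
  open import Relation.Binary.Reasoning.Setoid setoid

  1≉0 : ¬ 1# ≈ 0#
  1≉0 1≈0 = proj₁ isField (sym 1≈0)

  inverse : ∀ x → ¬ x ≈ 0# → ∃ λ y → x * y ≈ 1#
  inverse = proj₂ isField

  pivot : ∀ {m} (x : Fin (suc m) → Carrier) →
          ∃₂ λ j (ρ : Fin m → Carrier) → ∀ i → x (punchIn j i) + ρ i * x j ≈ 0#
  pivot x with Fin.any? (λ j → ¬? (x j ≟ 0#))
  ... | yes (j , xⱼ≉0) = j , (λ i → - (x (punchIn j i) * π)) , λ i → cleared (x (punchIn j i))
    where
    π = proj₁ (inverse (x j) xⱼ≉0)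
    xⱼπ≈1 = proj₂ (inverse (x j) xⱼ≉0)
    cleared : ∀ y → y + - (y * π) * x j ≈ 0#
    cleared y = begin
      y + - (y * π) * x j    ≈⟨ +-congˡ (sym (-‿distribˡ-* (y * π) (x j))) ⟩
      y + - (y * π * x j)    ≈⟨ +-congˡ (-‿cong (trans (*-assoc y π (x j)) (*-congˡ (trans (*-comm π (x j)) xⱼπ≈1)))) ⟩
      y + - (y * 1#)         ≈⟨ +-congˡ (-‿cong (*-identityʳ y)) ⟩
      y + - y                ≈⟨ -‿inverseʳ y ⟩
      0#                     ∎
  ... | no ∄xⱼ≉0 = zero , (λ _ → 0#) , λ i → trans (+-cong (xₛᵢ≈0 i) (zeroˡ (x zero))) (+-identityʳ 0#)
    where
    xₛᵢ≈0 : ∀ i → x (suc i) ≈ 0#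
    xₛᵢ≈0 i = decidable-stable (x (suc i) ≟ 0#) (λ xₛᵢ≉0 → ∄xⱼ≉0 (suc i , xₛᵢ≉0))

  many-vectors-dependent : ∀ m (v : Fin (suc m) → Vector F m) → LinearlyDependent v
  many-vectors-dependent zero    v = (λ _ → 1#) , (zero , 1≉0) , λ ()
  many-vectors-dependent (suc m) v with pivot (λ i → v i zero)
  ... | j , ρ , cleared = dependent-of-eliminated j ρ v
          (dependent-of-tails (eliminate j ρ v) cleared
            (many-vectors-dependent m (λ i → tail (eliminate j ρ v i))))

  spannedByFewer⇒dependent : ∀ {m d} (u : Fin m → Vector F d) (y : Fin (suc m) → Vector F d) →
    (∀ j → InSpan F u (y j)) → LinearlyDependent y
  spannedByFewer⇒dependent {m} u y y∈⟨u⟩ = dependent-of-coordinates (λ j → proj₁ (y∈⟨u⟩ j)) u y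
    (λ j → proj₂ (y∈⟨u⟩ j)) (many-vectors-dependent m (λ j → proj₁ (y∈⟨u⟩ j)))

  dependent-member-inSpan : ∀ {m d} {v : Fin (suc m) → Vector F d} {a} j → ¬ a j ≈ 0# →
    lincomb F a v ≋ 0ᵥ F → InSpan F (removeAt v j) (v j)
  dependent-member-inSpan {v = v} {a} j aⱼ≉0 Σ≈0 = (λ t → - α * removeAt a j t) , λ e → sym (begin
    v j e                                                      ≈⟨ solve-for (trans (sym (lincomb-removeAt a v j e)) (Σ≈0 e)) ⟩
    - α * lincomb F (removeAt a j) (removeAt v j) e            ≈⟨ *-lincomb (- α) (removeAt a j) (removeAt v j) e ⟩
    lincomb F (λ t → - α * removeAt a j t) (removeAt v j) e    ∎)
    where
    α = proj₁ (inverse (a j) aⱼ≉0)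
    αaⱼ≈1 = trans (*-comm α (a j)) (proj₂ (inverse (a j) aⱼ≉0))
    solve-for : ∀ {z S} → a j * z + S ≈ 0# → z ≈ - α * S
    solve-for {z} {S} aⱼz+S≈0 = begin
      z                ≈⟨ *-identityˡ z ⟨
      1# * z           ≈⟨ *-congʳ αaⱼ≈1 ⟨
      α * a j * z      ≈⟨ *-assoc α (a j) z ⟩
      α * (a j * z)    ≈⟨ *-congˡ (+-inverseˡ-unique (a j * z) S aⱼz+S≈0) ⟩
      α * - S          ≈⟨ -‿distribʳ-* α S ⟨
      - (α * S)        ≈⟨ -‿distribˡ-* α S ⟩
      - α * S          ∎

  dependent⇒spannedByFewer : ∀ {m d} (y : Fin (suc m) → Vector F d) → LinearlyDependent y →
    ∃ λ (u : Fin m → Vector F d) → ∀ j → InSpan F u (y j)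
  dependent⇒spannedByFewer y (a , (i , aᵢ≉0) , Σ≈0) = removeAt y i , y∈⟨u⟩
    where
    y∈⟨u⟩ : ∀ j → InSpan F (removeAt y i) (y j)
    y∈⟨u⟩ j with i Fin.≟ j
    ... | yes ≡.refl = dependent-member-inSpan {v = y} {a} i aᵢ≉0 Σ≈0
    ... | no i≢j = ≡.subst (InSpan F (removeAt y i)) (removeAt-punchOut y i≢j)
                           (inSpan-member (removeAt y i) (punchOut i≢j))

module SparseCombinations {c ℓ} (F : CommutativeRing c ℓ) {p : ℕ} (order : HasOrder F (suc p)) where
  open CommutativeRing F hiding (zero)
  open LinearAlgebra F
  open Inverse (Bijection⇒Inverse order) using (to; from; to-cong; strictlyInverseˡ; strictlyInverseʳ)
  open Bijection order using (injective)
  open import Relation.Binary.Reasoning.Setoid setoid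

  infix 4 _≟_
  _≟_ : Decidable _≈_
  x ≟ y = map′ injective to-cong (to x Fin.≟ to y)

  nonzero : Fin p → Carrier
  nonzero j = from (punchIn (to 0#) j)

  nonzero-surjective : ∀ x → ¬ x ≈ 0# → ∃ λ j → nonzero j ≈ x
  nonzero-surjective x x≉0 = punchOut 0≢x , (begin
    from (punchIn (to 0#) (punchOut 0≢x))  ≡⟨ ≡.cong from (Fin.punchIn-punchOut 0≢x) ⟩
    from (to x)                            ≈⟨ strictlyInverseʳ x ⟩
    x                                      ∎)
    where
    0≢x : to 0# ≢ to x
    0≢x 0≡x = x≉0 (sym (injective 0≡x))

  nonzeroIndicator : Carrier → ℕ
  nonzeroIndicator x with x ≟ 0#
  ... | yes _ = 0
  ... | no  _ = 1

  nonzeroIndicator≤1 : ∀ x → nonzeroIndicator x ≤ 1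
  nonzeroIndicator≤1 x with x ≟ 0#
  ... | yes _ = z≤n
  ... | no  _ = s≤s z≤n

  nonzeroIndicator-≈0 : ∀ {x} → x ≈ 0# → nonzeroIndicator x ≡ 0
  nonzeroIndicator-≈0 {x} x≈0 with x ≟ 0#
  ... | yes _  = ≡.refl
  ... | no x≉0 = contradiction x≈0 x≉0

  nonzeroIndicator-+ : ∀ x y → nonzeroIndicator (x + y) ≤ nonzeroIndicator x ℕ.+ nonzeroIndicator y
  nonzeroIndicator-+ x y with x ≟ 0# | y ≟ 0# | x + y ≟ 0#
  ... | _       | _       | yes _    = z≤n
  ... | yes x≈0 | yes y≈0 | no x+y≉0 = contradiction (trans (+-cong x≈0 y≈0) (+-identityʳ 0#)) x+y≉0
  ... | yes _   | no _    | no _     = s≤s z≤n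
  ... | no _    | _       | no _     = s≤s z≤n

  support : ∀ {k} → (Fin k → Carrier) → ℕ
  support {zero}  a = 0
  support {suc k} a = nonzeroIndicator (a zero) ℕ.+ support (tail a)

  support-zeros : ∀ {k} → support {k} (λ _ → 0#) ≡ 0
  support-zeros {zero}  = ≡.refl
  support-zeros {suc k} = ≡.cong₂ ℕ._+_ (nonzeroIndicator-≈0 refl) (support-zeros {k})

  support-+ : ∀ {k} (a b : Fin k → Carrier) → support (λ i → a i + b i) ≤ support a ℕ.+ support b
  support-+ {zero}  a b = z≤n
  support-+ {suc k} a b = ℕ.≤-trans
    (ℕ.+-mono-≤ (nonzeroIndicator-+ (a zero) (b zero)) (support-+ (tail a) (tail b)))
    (ℕ.≤-reflexive (interchange (nonzeroIndicator (a zero)) (nonzeroIndicator (b zero)) (support (tail a)) (support (tail b))))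
    where open import Algebra.Properties.CommutativeSemigroup ℕ.+-commutativeSemigroup using (interchange)

  support-single : ∀ {k} (j : Fin k) x → support (single j x) ≤ 1
  support-single {suc k}       zero    x = ℕ.+-mono-≤ (nonzeroIndicator≤1 x) (ℕ.≤-reflexive (support-zeros {k}))
  support-single {suc (suc _)} (suc j) x = ℕ.+-mono-≤ (ℕ.≤-reflexive (nonzeroIndicator-≈0 refl)) (support-single j x)

  support-pushforward : ∀ {m k} (τ : Fin m → Fin k) c → support (pushforward τ c) ≤ m
  support-pushforward {zero}  {k} τ c = ℕ.≤-reflexive (support-zeros {k})
  support-pushforward {suc m} τ c = ℕ.≤-trans
    (support-+ (single (τ zero) (c zero)) (pushforward (τ ∘ suc) (c ∘ suc)))
    (ℕ.+-mono-≤ (support-single (τ zero) (c zero)) (support-pushforward (τ ∘ suc) (c ∘ suc)))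

  -- Coefficient vectors of F^k with at most r nonzero entries, a nonzero entry being an index into nonzero.
  Sparse : ℕ → ℕ → Set
  Sparse zero    r       = ⊤
  Sparse (suc k) zero    = Sparse k zero
  Sparse (suc k) (suc r) = Sparse k (suc r) ⊎ (Fin p × Sparse k r)

  sparse↔ : ∀ {k r} → Sparse k r ↔ Fin (sparseCount p k r)
  sparse↔ {zero}          = ↔-sym Fin.1↔⊤
  sparse↔ {suc k} {zero}  = sparse↔ {k}
  sparse↔ {suc k} {suc r} =
    ↔-trans (sparse↔ {k} ⊎-↔ (↔-refl ×-↔ sparse↔ {k})) (↔-trans (↔-refl ⊎-↔ ↔-sym Fin.*↔×) (↔-sym Fin.+↔⊎))

  coefficients : ∀ {k r} → Sparse k r → Fin k → Carrier
  coefficients {suc k} {zero}  s              = 0# ∷ coefficients s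
  coefficients {suc k} {suc r} (inj₁ s)       = 0# ∷ coefficients s
  coefficients {suc k} {suc r} (inj₂ (j , s)) = nonzero j ∷ coefficients s

  coefficients-surjective : ∀ {k r} (a : Fin k → Carrier) → support a ≤ r →
    ∃ λ (s : Sparse k r) → ∀ i → coefficients s i ≈ a i
  coefficients-surjective {zero} a _ = tt , λ ()
  coefficients-surjective {suc k} {r} a supp≤r with a zero ≟ 0#
  coefficients-surjective {suc k} {zero} a supp≤r | yes a₀≈0 =
    let s , s≈ = coefficients-surjective (tail a) supp≤r in s , λ { zero → sym a₀≈0 ; (suc i) → s≈ i }
  coefficients-surjective {suc k} {suc r} a supp≤r | yes a₀≈0 =
    let s , s≈ = coefficients-surjective (tail a) supp≤r in inj₁ s , λ { zero → sym a₀≈0 ; (suc i) → s≈ i }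
  coefficients-surjective {suc k} {zero} a () | no a₀≉0
  coefficients-surjective {suc k} {suc r} a (s≤s supp≤r) | no a₀≉0 =
    let j , j≈ = nonzero-surjective (a zero) a₀≉0
        s , s≈ = coefficients-surjective (tail a) supp≤r
    in inj₂ (j , s) , λ { zero → j≈ ; (suc i) → s≈ i }

  SparselySpanned : ∀ {k d} → ℕ → (Fin k → Vector F d) → Vector F d → Set ℓ
  SparselySpanned {k} r X w = ∃ λ (s : Sparse k r) → lincomb F (coefficients s) X ≋ w

  sparselySpanned? : ∀ {k d} r (X : Fin k → Vector F d) w → Dec (SparselySpanned r X w)
  sparselySpanned? {k} r X w = map′
    (λ (i , Σ≋w) → S.from i , Σ≋w)
    (λ (s , Σ≋w) → S.to s , ≡.subst (λ s → lincomb F (coefficients s) X ≋ w) (≡.sym (S.strictlyInverseʳ s)) Σ≋w)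
    (Fin.any? λ i → Fin.all? λ e → lincomb F (coefficients (S.from i)) X e ≟ w e)
    where module S = Inverse (sparse↔ {k} {r})

  spannedBy≤⇒sparselySpanned : ∀ {k d r} {X : Fin k → Vector F d} {w} →
    SpannedBy≤ r X w → SparselySpanned r X w
  spannedBy≤⇒sparselySpanned {X = X} {w} (m , m≤r , τ , c , Σc≋w) = s , λ e → begin
    lincomb F (coefficients s) X e      ≈⟨ lincomb-cong s≈a (λ _ → refl) ⟩
    lincomb F (pushforward τ c) X e     ≈⟨ lincomb-pushforward τ c X e ⟩
    lincomb F c (λ i → X (τ i)) e       ≈⟨ Σc≋w e ⟩
    w e                                 ∎
    where
    sparse = coefficients-surjective (pushforward τ c) (ℕ.≤-trans (support-pushforward τ c) m≤r)
    s = proj₁ sparse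
    s≈a = proj₂ sparse

  decode : ∀ {d} → Fin (suc p ℕ.^ d) → Vector F d
  decode {d} x e = from (Fin.finToFun {suc p} {d} x e)

  decode-injective : ∀ {d} {x y : Fin (suc p ℕ.^ d)} → decode x ≋ decode y → x ≡ y
  decode-injective {d} {x} {y} dx≋dy = ≡.trans (≡.sym (Fin.funToFin-finToFin {d} {suc p} x))
    (≡.trans (funToFin-cong entries≡) (Fin.funToFin-finToFin {d} {suc p} y))
    where
    entries≡ : ∀ e → Fin.finToFun {suc p} {d} x e ≡ Fin.finToFun {suc p} {d} y e
    entries≡ e = ≡.trans (≡.sym (strictlyInverseˡ _)) (≡.trans (to-cong (dx≋dy e)) (strictlyInverseˡ _))

  sparselySpanned⇒count : ∀ {k d r} (X : Fin k → Vector F d) → (∀ w → SparselySpanned r X w) →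
    suc p ℕ.^ d ≤ sparseCount p k r
  sparselySpanned⇒count {k} {d} {r} X spanned = Fin.injective⇒≤ code-injective
    where
    module S = Inverse (sparse↔ {k} {r})
    code : Fin (suc p ℕ.^ d) → Fin (sparseCount p k r)
    code x = S.to (proj₁ (spanned (decode x)))
    code-injective : ∀ {x y} → code x ≡ code y → x ≡ y
    code-injective {x} {y} code≡ = decode-injective λ e → begin
      decode x e                                                  ≈⟨ proj₂ (spanned (decode x)) e ⟨
      lincomb F (coefficients (proj₁ (spanned (decode x)))) X e
        ≡⟨ ≡.cong (λ s → lincomb F (coefficients s) X e) same-sparse ⟩
      lincomb F (coefficients (proj₁ (spanned (decode y)))) X e   ≈⟨ proj₂ (spanned (decode y)) e ⟩
      decode y e                                                  ∎
      where
      same-sparse : proj₁ (spanned (decode x)) ≡ proj₁ (spanned (decode y))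
      same-sparse = ≡.trans (≡.sym (S.strictlyInverseʳ _)) (≡.trans (≡.cong S.from code≡) (S.strictlyInverseʳ _))

module Geometry {c ℓ} (F : CommutativeRing c ℓ) (isField : IsField F) {p : ℕ} (order : HasOrder F (suc p)) where
  open CommutativeRing F hiding (zero)
  open LinearAlgebra F
  open SparseCombinations F order using (_≟_; sparselySpanned?; spannedBy≤⇒sparselySpanned; sparselySpanned⇒count)
  open LinearAlgebraOverField F isField _≟_
  open import Relation.Binary.Reasoning.Setoid setoid

  Independent : ∀ {k d} → ℕ → (Fin k → Vector F d) → Set (c ⊔ ℓ)
  Independent {k} r X = ∀ (σ : Fin r → Fin k) → Injective _≡_ _≡_ σ → ¬ LinearlyDependent (λ i → X (σ i))

  independent-pred : ∀ {k d r} {X : Fin k → Vector F d} → r < k → Independent (suc r) X → Independent r X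
  independent-pred {X = X} r<k independent σ σ-injective dependent =
    independent (t ∷ σ) t∷σ-injective (dependent-∷ (X t) dependent)
    where
    t = proj₁ (∃∉image r<k σ)
    t∉σ = proj₂ (∃∉image r<k σ)
    t∷σ-injective : Injective _≡_ _≡_ (t ∷ σ)
    t∷σ-injective {zero}  {zero}  _  = ≡.refl
    t∷σ-injective {zero}  {suc j} eq = contradiction (≡.sym eq) (t∉σ j)
    t∷σ-injective {suc i} {zero}  eq = contradiction eq (t∉σ i)
    t∷σ-injective {suc i} {suc j} eq = ≡.cong suc (σ-injective eq)

  is4General⇒independent : ∀ {n k} {X : Fin k → Vector F (suc n)} → Is4General F n X → Independent 4 X
  is4General⇒independent (_ , _ , noFourOnAPlane) σ σ-injective dependent =
    noFourOnAPlane σ σ-injective (dependent⇒spannedByFewer _ dependent)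

  samePoint-sym : ∀ {d} {u v : Vector F d} → ¬ u ≋ 0ᵥ F → SamePoint F u v → SamePoint F v u
  samePoint-sym {u = u} {v} u≉0 (γ , u≋γv) with γ ≟ 0#
  ... | yes γ≈0 = contradiction (λ e → trans (u≋γv e) (trans (*-congʳ γ≈0) (zeroˡ (v e)))) u≉0
  ... | no γ≉0 = γ⁻¹ , λ e → begin
    v e               ≈⟨ *-identityˡ (v e) ⟨
    1# * v e          ≈⟨ *-congʳ γ⁻¹γ≈1 ⟨
    γ⁻¹ * γ * v e     ≈⟨ *-assoc γ⁻¹ γ (v e) ⟩
    γ⁻¹ * (γ * v e)   ≈⟨ *-congˡ (u≋γv e) ⟨
    γ⁻¹ * u e         ∎
    where
    γ⁻¹ = proj₁ (inverse γ γ≉0)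
    γ⁻¹γ≈1 = trans (*-comm γ⁻¹ γ) (proj₂ (inverse γ γ≉0))

  module Extension {n k} (X : Fin k → Vector F (suc n)) (w : Vector F (suc n)) where

    extend-avoiding : ∀ {m} {σ : Fin m → Fin (suc k)} (σ≢0 : ∀ j → zero ≢ σ j) →
      ∀ j → extend F w X (σ j) ≋ X (punchOut (σ≢0 j))
    extend-avoiding {σ = σ} σ≢0 j with σ j | σ≢0 j
    ... | zero  | 0≢0 = contradiction ≡.refl 0≢0
    ... | suc i | _   = λ _ → refl

    independent-avoiding : ∀ {m} → Independent m X → (σ : Fin m → Fin (suc k)) → Injective _≡_ _≡_ σ →
      (∀ j → zero ≢ σ j) → ¬ LinearlyDependent (λ j → extend F w X (σ j))
    independent-avoiding independent σ σ-injective σ≢0 dependent = independent (λ j → punchOut (σ≢0 j))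
      (λ eq → σ-injective (Fin.punchOut-injective (σ≢0 _) (σ≢0 _) eq))
      (dependent-resp (extend-avoiding σ≢0) dependent)

    extension-independent : Independent 4 X → Independent 3 X → ¬ SpannedBy≤ 3 X w →
                            Independent 4 (extend F w X)
    extension-independent independent₄ independent₃ w∉⟨X⟩ σ σ-injective dependent@(a , nontrivial , Σ≈0)
      with Fin.any? (λ j → σ j Fin.≟ zero)
    ... | no w∉σ = independent-avoiding independent₄ σ σ-injective (λ j 0≡σⱼ → w∉σ (j , ≡.sym 0≡σⱼ)) dependent
    ... | yes (j , σⱼ≡0) = through-w (a j ≟ 0#)
      where
      σ′≢0 : ∀ i → zero ≢ σ (punchIn j i)
      σ′≢0 i 0≡σ′ᵢ = Fin.punchInᵢ≢i j i (σ-injective (≡.trans (≡.sym 0≡σ′ᵢ) (≡.sym σⱼ≡0)))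
      through-w : Dec (a j ≈ 0#) → ⊥
      through-w (yes aⱼ≈0) =
        independent-avoiding independent₃ (σ ∘ punchIn j) (Fin.punchIn-injective j _ _ ∘ σ-injective) σ′≢0
          (dependent-removeAt {v = λ i → extend F w X (σ i)} j aⱼ≈0 nontrivial Σ≈0)
      through-w (no aⱼ≉0) = w∉⟨X⟩ (3 , ℕ.≤-refl , (λ i → punchOut (σ′≢0 i)) ,
        inSpan-resp (extend-avoiding σ′≢0) (λ e → reflexive (≡.cong (λ i → extend F w X i e) σⱼ≡0))
                    (dependent-member-inSpan {v = λ i → extend F w X (σ i)} {a} j aⱼ≉0 Σ≈0))

    extension-isPointSet : IsPointSet F n X → ¬ w ≋ 0ᵥ F → (∀ i → ¬ SamePoint F w (X i)) →
                           IsPointSet F n (extend F w X)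
    extension-isPointSet (X≉0 , X-distinct) w≉0 w≁X = extended≉0 , extended-distinct
      where
      extended≉0 : ∀ i → ¬ extend F w X i ≋ 0ᵥ F
      extended≉0 zero    = w≉0
      extended≉0 (suc i) = X≉0 i
      extended-distinct : ∀ i j → i ≢ j → ¬ SamePoint F (extend F w X i) (extend F w X j)
      extended-distinct zero    zero    0≢0 = contradiction ≡.refl 0≢0
      extended-distinct zero    (suc j) _   = w≁X j
      extended-distinct (suc i) zero    _   = w≁X i ∘ samePoint-sym (X≉0 i)
      extended-distinct (suc i) (suc j) i≢j = X-distinct i j (i≢j ∘ ≡.cong suc)

    extension-spans : SpansPG F n X → SpansPG F n (extend F w X)
    extension-spans spans v = 0# ∷ proj₁ (spans v) , λ e →
      trans (+-congʳ (zeroˡ (w e))) (trans (+-identityˡ _) (proj₂ (spans v) e))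

  complete⇒spannedBy≤3 : ∀ {n k} {X : Fin k → Vector F (suc n)} → IsComplete4General F n X →
    ∀ w → ¬ ¬ SpannedBy≤ 3 X w
  complete⇒spannedBy≤3 {k = k} {X} ((isPointSet , spans , noFourOnAPlane) , complete) w w∉⟨X⟩
    with 4 ℕ.≤? k
  ... | no k≱4 = w∉⟨X⟩ (k , ℕ.≤-pred (ℕ.≰⇒> k≱4) , id , spans w)
  ... | yes k≥4 = complete w w≉0 w≁X
        (extension-isPointSet isPointSet w≉0 w≁X , extension-spans spans ,
         λ σ σ-injective (u , onPlane) → extension-independent independent₄ independent₃ w∉⟨X⟩ σ σ-injective
                                           (spannedByFewer⇒dependent u _ onPlane))
    where
    open Extension X w
    independent₄ = is4General⇒independent {X = X} (isPointSet , spans , noFourOnAPlane)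
    independent₃ = independent-pred {X = X} k≥4 independent₄
    w≉0 : ¬ w ≋ 0ᵥ F
    w≉0 w≋0 = w∉⟨X⟩ (0 , z≤n , (λ ()) , (λ ()) , λ e → sym (w≋0 e))
    w≁X : ∀ i → ¬ SamePoint F w (X i)
    w≁X i (γ , w≋γXᵢ) = w∉⟨X⟩ (1 , s≤s z≤n , (λ _ → i) , (λ _ → γ) , λ e → trans (+-identityʳ _) (sym (w≋γXᵢ e)))

  complete⇒count : ∀ {n k} {X : Fin k → Vector F (suc n)} → IsComplete4General F n X →
    suc p ℕ.^ suc n ≤ sparseCount p k 3
  complete⇒count {X = X} complete = sparselySpanned⇒count X λ w →
    decidable-stable (sparselySpanned? 3 X w)
      (λ ¬sparse → complete⇒spannedBy≤3 complete w (¬sparse ∘ spannedBy≤⇒sparselySpanned))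

prime-power≥2 : ∀ {q} → IsPrimePower q → 2 ≤ q
prime-power≥2 (p , e , p-prime , ≡.refl) =
  ℕ.*-mono-≤ (ℕ.nonTrivial⇒n>1 p {{prime⇒nonTrivial p-prime}}) (ℕ.m^n>0 p {{prime⇒nonZero p-prime}} e)

proposition3p2 : ∀ {c ℓ} (F : CommutativeRing c ℓ) → IsField F
    → (q : ℕ) → IsPrimePower q → HasOrder F q
    → (n : ℕ) → 2 ≤ n
    → (k : ℕ) (X : Fin k → Vector F (suc n))
    → IsComplete4General F n X
    → CubeRootBound q n k
proposition3p2 F isField zero q-prime-power = contradiction (prime-power≥2 q-prime-power) λ ()
proposition3p2 F isField (suc p) q-prime-power order n 2≤n k X complete =
  cubeRootBound-of-sparseCount p n k (ℕ.s≤s⁻¹ (prime-power≥2 q-prime-power)) (ℕ.<⇒≤ 2≤n)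
    (Geometry.complete⇒count F isField order complete)
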